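{- The monoid $\mathrm{Styl}(A)$ is $J$-trivial: for all $u,v\in\mathrm{Styl}(A)$, if $\mathrm{Styl}(A)\,u\,\mathrm{Styl}(A)=\mathrm{Styl}(A)\,v\,\mathrm{Styl}(A)$ then $u=v$.
   Context: $A$ is a finite totally ordered alphabet and $A^*$ the free monoid on $A$. A column is a subset of $A$, identified with the strictly decreasing word of its elements. For a column $\gamma$ and a letter $x$: if $x>y$ for all $y\in\gamma$, let $x\cdot\gamma=\gamma\cup\{x\}$; otherwise let $y$ be the smallest element of $\gamma$ with $y\geq x$ and let $x\cdot\gamma=(\gamma\setminus\{y\})\cup\{x\}$. This extends to a left action of $A^*$ on the set of columns by $(uv)\cdot\gamma=u\cdot(v\cdot\gamma)$. $\mathrm{Styl}(A)$ is the monoid of maps of the set of columns to itself induced by words under this action. -}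

module Defs where

open import Data.Nat using (ℕ; _≤ᵇ_)
open import Data.Fin using (Fin; toℕ)
open import Data.Fin.Subset using (Subset; inside; outside)
open import Data.Bool using (Bool; _∧_)
open import Data.Vec using (lookup; _[_]≔_)
open import Data.List using (List; []; _∷_; _++_; allFin; filterᵇ)
open import Data.Product using (Σ; _×_)
open import Relation.Binary.PropositionalEquality using (_≡_)

-- The alphabet A is Fin n with its natural total order (every finite
-- totally ordered alphabet is order-isomorphic to one of these).
-- A column is a subset of A.
Column : ℕ → Set
Column n = Subset n

Word : ℕ → Set
Word n = List (Fin n)

-- smallest y ∈ γ with y ≥ x, searched through the increasing list allFin n
candidates : ∀ {n} → Fin n → Column n → List (Fin n)
candidates {n} x γ = filterᵇ (λ y → lookup γ y ∧ (toℕ x ≤ᵇ toℕ y)) (allFin n)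

letterAct : ∀ {n} → Fin n → Column n → Column n
letterAct x γ with candidates x γ
... | []    = γ [ x ]≔ inside
... | y ∷ _ = (γ [ y ]≔ outside) [ x ]≔ inside

act : ∀ {n} → Word n → Column n → Column n
act []      γ = γ
act (x ∷ w) γ = letterAct x (act w γ)

-- Two words define the same element of Styl(A) iff they induce the same
-- map on columns.
_≈S_ : ∀ {n} → Word n → Word n → Set
u ≈S v = ∀ γ → act u γ ≡ act v γ

IdealSub : ∀ {n} → Word n → Word n → Set
IdealSub {n} u v =
  ∀ (p q : Word n) → Σ (Word n) λ p' → Σ (Word n) λ q' →
    (p ++ u ++ q) ≈S (p' ++ v ++ q')

SameIdeal : ∀ {n} → Word n → Word n → Set
SameIdeal u v = IdealSub u v × IdealSub v u

-- Count, for each letter t, the elements of a column that are ≤ t. A letter x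
-- either adds x or replaces some y ≥ x by x, so every such count can only grow,
-- and the growth is monotone in the column. Hence the action of any word is
-- extensive and monotone for the pointwise order on counts. If u = p v q in
-- Styl(A), then u·γ = p·(v·(q·γ)) dominates v·γ; the symmetric inclusion of
-- ideals gives the reverse domination, and a column is determined by its counts.
module Submission where

open import Defs
open import Data.Nat using (ℕ; zero; suc; _+_; _≤_; _⊔_; pred; _≤ᵇ_; _<ᵇ_; z≤n)
open import Data.Nat.Properties
open import Data.Fin using (Fin; toℕ; zero; suc)
open import Data.Fin.Subset using (inside; outside)
open import Data.Bool using (Bool; true; false; _∧_)
open import Data.Bool.Properties using (∧-identityʳ; ∧-zeroʳ)
open import Data.Vec using ([]; _∷_; lookup; _[_]≔_)
open import Data.List using (List; []; _∷_; _++_; allFin; filterᵇ; map)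
open import Data.List.Properties using (map-tabulate; ++-identityʳ)
open import Data.Product using (_,_)
open import Function using (_∘_; id)
open import Relation.Binary.PropositionalEquality

private
  variable
    n : ℕ

filterᵇ-cong : {A : Set} {P Q : A → Bool} → (∀ x → P x ≡ Q x) → filterᵇ P ≗ filterᵇ Q
filterᵇ-cong         P≗Q []       = refl
filterᵇ-cong {P = P} {Q} P≗Q (x ∷ xs) with P x | Q x | P≗Q x
... | true  | .true  | refl = cong (x ∷_) (filterᵇ-cong P≗Q xs)
... | false | .false | refl = filterᵇ-cong P≗Q xs

filterᵇ-map : {A B : Set} (P : B → Bool) (f : A → B) →
              filterᵇ P ∘ map f ≗ map f ∘ filterᵇ (P ∘ f)
filterᵇ-map P f []       = refl
filterᵇ-map P f (x ∷ xs) with P (f x)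
... | true  = cong (f x ∷_) (filterᵇ-map P f xs)
... | false = filterᵇ-map P f xs

filterᵇ-reject : {A : Set} (P : A → Bool) {x : A} {xs : List A} →
                 P x ≡ false → filterᵇ P (x ∷ xs) ≡ filterᵇ P xs
filterᵇ-reject P Px≡false rewrite Px≡false = refl

allFin-suc : ∀ n → allFin (suc n) ≡ zero ∷ map suc (allFin n)
allFin-suc n = cong (zero ∷_) (sym (map-tabulate id suc))

m<ᵇ1+n≡m≤ᵇn : ∀ m n → (m <ᵇ suc n) ≡ (m ≤ᵇ n)
m<ᵇ1+n≡m≤ᵇn zero    n = refl
m<ᵇ1+n≡m≤ᵇn (suc m) n = refl

elements : Column n → List (Fin n)
elements {n} γ = filterᵇ (lookup γ) (allFin n)

elements-false : (γ : Column n) → elements (false ∷ γ) ≡ map suc (elements γ)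
elements-false {n} γ =
  trans (cong (filterᵇ (lookup (false ∷ γ))) (allFin-suc n))
        (filterᵇ-map (lookup (false ∷ γ)) suc (allFin n))

candidates-zero : (γ : Column (suc n)) → candidates zero γ ≡ elements γ
candidates-zero γ = filterᵇ-cong (λ y → ∧-identityʳ (lookup γ y)) (allFin _)

candidates-suc : ∀ (x : Fin n) b γ → candidates (suc x) (b ∷ γ) ≡ map suc (candidates x γ)
candidates-suc {n} x b γ = begin
  candidates (suc x) (b ∷ γ)
    ≡⟨ cong (filterᵇ P) (allFin-suc n) ⟩
  filterᵇ P (zero ∷ map suc (allFin n))
    ≡⟨ filterᵇ-reject P {zero} {map suc (allFin n)} (∧-zeroʳ b) ⟩
  filterᵇ P (map suc (allFin n))
    ≡⟨ filterᵇ-map P suc (allFin n) ⟩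
  map suc (filterᵇ (P ∘ suc) (allFin n))
    ≡⟨ cong (map suc) (filterᵇ-cong (λ y → cong (lookup γ y ∧_) (m<ᵇ1+n≡m≤ᵇn (toℕ x) (toℕ y))) (allFin n)) ⟩
  map suc (candidates x γ) ∎
  where
  open ≡-Reasoning
  P : Fin (suc n) → Bool
  P y = lookup (b ∷ γ) y ∧ (toℕ (suc x) ≤ᵇ toℕ y)

deleteFirst : List (Fin n) → Column n → Column n
deleteFirst []      γ = γ
deleteFirst (y ∷ _) γ = γ [ y ]≔ outside

deleteFirst-map-suc : ∀ (ys : List (Fin n)) b γ → deleteFirst (map suc ys) (b ∷ γ) ≡ b ∷ deleteFirst ys γ
deleteFirst-map-suc []      b γ = refl
deleteFirst-map-suc (y ∷ _) b γ = refl

letterAct-deleteFirst : (x : Fin n) (γ : Column n) → letterAct x γ ≡ deleteFirst (candidates x γ) γ [ x ]≔ inside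
letterAct-deleteFirst x γ with candidates x γ
... | []    = refl
... | _ ∷ _ = refl

removeMin : Column n → Column n
removeMin []          = []
removeMin (true ∷ γ)  = false ∷ γ
removeMin (false ∷ γ) = false ∷ removeMin γ

insert : Fin n → Column n → Column n
insert zero    (true ∷ γ)  = true ∷ γ
insert zero    (false ∷ γ) = true ∷ removeMin γ
insert (suc x) (b ∷ γ)     = b ∷ insert x γ

removeMin-deleteFirst : (γ : Column n) → removeMin γ ≡ deleteFirst (elements γ) γ
removeMin-deleteFirst []          = refl
removeMin-deleteFirst (true ∷ γ)  = refl
removeMin-deleteFirst (false ∷ γ) = begin
  false ∷ removeMin γ                           ≡⟨ cong (false ∷_) (removeMin-deleteFirst γ) ⟩
  false ∷ deleteFirst (elements γ) γ            ≡⟨ sym (deleteFirst-map-suc (elements γ) false γ) ⟩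
  deleteFirst (map suc (elements γ)) (false ∷ γ) ≡⟨ cong (λ ys → deleteFirst ys (false ∷ γ)) (sym (elements-false γ)) ⟩
  deleteFirst (elements (false ∷ γ)) (false ∷ γ) ∎
  where open ≡-Reasoning

letterAct≡insert : (x : Fin n) (γ : Column n) → letterAct x γ ≡ insert x γ
letterAct≡insert zero (true ∷ γ) = refl
letterAct≡insert zero (false ∷ γ) = begin
  letterAct zero (false ∷ γ)
    ≡⟨ letterAct-deleteFirst zero (false ∷ γ) ⟩
  deleteFirst (candidates zero (false ∷ γ)) (false ∷ γ) [ zero ]≔ inside
    ≡⟨ cong (λ ys → deleteFirst ys (false ∷ γ) [ zero ]≔ inside) (trans (candidates-zero (false ∷ γ)) (elements-false γ)) ⟩
  deleteFirst (map suc (elements γ)) (false ∷ γ) [ zero ]≔ inside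
    ≡⟨ cong (_[ zero ]≔ inside) (deleteFirst-map-suc (elements γ) false γ) ⟩
  true ∷ deleteFirst (elements γ) γ
    ≡⟨ cong (true ∷_) (sym (removeMin-deleteFirst γ)) ⟩
  true ∷ removeMin γ ∎
  where open ≡-Reasoning
letterAct≡insert (suc x) (b ∷ γ) = begin
  letterAct (suc x) (b ∷ γ)
    ≡⟨ letterAct-deleteFirst (suc x) (b ∷ γ) ⟩
  deleteFirst (candidates (suc x) (b ∷ γ)) (b ∷ γ) [ suc x ]≔ inside
    ≡⟨ cong (λ ys → deleteFirst ys (b ∷ γ) [ suc x ]≔ inside) (candidates-suc x b γ) ⟩
  deleteFirst (map suc (candidates x γ)) (b ∷ γ) [ suc x ]≔ inside
    ≡⟨ cong (_[ suc x ]≔ inside) (deleteFirst-map-suc (candidates x γ) b γ) ⟩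
  b ∷ deleteFirst (candidates x γ) γ [ x ]≔ inside
    ≡⟨ cong (b ∷_) (sym (letterAct-deleteFirst x γ)) ⟩
  b ∷ letterAct x γ
    ≡⟨ cong (b ∷_) (letterAct≡insert x γ) ⟩
  b ∷ insert x γ ∎
  where open ≡-Reasoning

indicator : Bool → ℕ
indicator true  = 1
indicator false = 0

indicator-injective : ∀ b c → indicator b ≡ indicator c → b ≡ c
indicator-injective true  true  _ = refl
indicator-injective false false _ = refl

countUpTo : Column n → ℕ → ℕ
countUpTo []      _       = 0
countUpTo (b ∷ γ) zero    = indicator b
countUpTo (b ∷ γ) (suc t) = indicator b + countUpTo γ t

countUpTo-injective : (γ δ : Column n) → (∀ t → countUpTo γ t ≡ countUpTo δ t) → γ ≡ δ
countUpTo-injective []      []      _ = refl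
countUpTo-injective (b ∷ γ) (c ∷ δ) γ≗δ with indicator-injective b c (γ≗δ zero)
... | refl = cong (b ∷_) (countUpTo-injective γ δ (λ t → +-cancelˡ-≡ (indicator b) _ _ (γ≗δ (suc t))))

countUpTo-removeMin : (γ : Column n) (t : ℕ) → countUpTo (removeMin γ) t ≡ pred (countUpTo γ t)
countUpTo-removeMin []          t       = refl
countUpTo-removeMin (true ∷ γ)  zero    = refl
countUpTo-removeMin (true ∷ γ)  (suc t) = refl
countUpTo-removeMin (false ∷ γ) zero    = refl
countUpTo-removeMin (false ∷ γ) (suc t) = countUpTo-removeMin γ t

countUpTo-insert-zero : (γ : Column (suc n)) (t : ℕ) → countUpTo (insert zero γ) t ≡ 1 ⊔ countUpTo γ t
countUpTo-insert-zero (true ∷ γ)  zero    = refl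
countUpTo-insert-zero (true ∷ γ)  (suc t) = refl
countUpTo-insert-zero (false ∷ γ) zero    = refl
countUpTo-insert-zero (false ∷ γ) (suc t) rewrite countUpTo-removeMin γ t with countUpTo γ t
... | zero  = refl
... | suc _ = refl

infix 4 _≼_

_≼_ : Column n → Column n → Set
γ ≼ δ = ∀ t → countUpTo γ t ≤ countUpTo δ t

insert-extensive : (x : Fin n) (γ : Column n) → γ ≼ insert x γ
insert-extensive zero    γ       t       rewrite countUpTo-insert-zero γ t = m≤n⊔m 1 (countUpTo γ t)
insert-extensive (suc x) (b ∷ γ) zero    = ≤-refl
insert-extensive (suc x) (b ∷ γ) (suc t) = +-monoʳ-≤ (indicator b) (insert-extensive x γ t)

-- The offsets a ≤ c account for the (possibly different) counts of the common
-- prefix of letters that the recursion has already passed.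
insert-mono-shifted : ∀ (x : Fin n) {a c} γ δ → a ≤ c →
  (∀ t → a + countUpTo γ t ≤ c + countUpTo δ t) →
  ∀ t → a + countUpTo (insert x γ) t ≤ c + countUpTo (insert x δ) t
insert-mono-shifted zero {a} {c} γ δ a≤c γ≼δ t
  rewrite countUpTo-insert-zero γ t | countUpTo-insert-zero δ t
        | +-distribˡ-⊔ a 1 (countUpTo γ t) | +-distribˡ-⊔ c 1 (countUpTo δ t)
  = ⊔-mono-≤ (+-monoˡ-≤ 1 a≤c) (γ≼δ t)
insert-mono-shifted (suc x) (b ∷ γ) (b′ ∷ δ) a≤c γ≼δ zero = γ≼δ zero
insert-mono-shifted (suc x) {a} {c} (b ∷ γ) (b′ ∷ δ) a≤c γ≼δ (suc t) =
  reassociate (insert-mono-shifted x γ δ (γ≼δ zero) (reassociate′ ∘ γ≼δ ∘ suc) t)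
  where
  reassociate : ∀ {m k} → a + indicator b + m ≤ c + indicator b′ + k →
                a + (indicator b + m) ≤ c + (indicator b′ + k)
  reassociate = subst₂ _≤_ (+-assoc a _ _) (+-assoc c _ _)
  reassociate′ : ∀ {m k} → a + (indicator b + m) ≤ c + (indicator b′ + k) →
                 a + indicator b + m ≤ c + indicator b′ + k
  reassociate′ = subst₂ _≤_ (sym (+-assoc a _ _)) (sym (+-assoc c _ _))

insert-mono : (x : Fin n) {γ δ : Column n} → γ ≼ δ → insert x γ ≼ insert x δ
insert-mono x {γ} {δ} γ≼δ = insert-mono-shifted x γ δ z≤n γ≼δ

act-++ : ∀ (u v : Word n) γ → act (u ++ v) γ ≡ act u (act v γ)
act-++ []      v γ = refl
act-++ (x ∷ u) v γ = cong (letterAct x) (act-++ u v γ)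

act-extensive : (w : Word n) (γ : Column n) → γ ≼ act w γ
act-extensive []      γ t = ≤-refl
act-extensive (x ∷ w) γ t rewrite letterAct≡insert x (act w γ) =
  ≤-trans (act-extensive w γ t) (insert-extensive x (act w γ) t)

act-mono : (w : Word n) {γ δ : Column n} → γ ≼ δ → act w γ ≼ act w δ
act-mono []      γ≼δ = γ≼δ
act-mono (x ∷ w) {γ} {δ} γ≼δ rewrite letterAct≡insert x (act w γ) | letterAct≡insert x (act w δ) =
  insert-mono x (act-mono w γ≼δ)

IdealSub⇒≽ : (u v : Word n) → IdealSub u v → ∀ γ → act v γ ≼ act u γ
IdealSub⇒≽ u v u∈JvJ γ t with u∈JvJ [] []
... | p , q , u≈pvq = subst (λ δ → countUpTo (act v γ) t ≤ countUpTo δ t) (sym u·γ≡p·v·q·γ)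
  (≤-trans (act-mono v (act-extensive q γ) t) (act-extensive p (act v (act q γ)) t))
  where
  u·γ≡p·v·q·γ : act u γ ≡ act p (act v (act q γ))
  u·γ≡p·v·q·γ = begin
    act u γ                 ≡⟨ cong (λ w → act w γ) (sym (++-identityʳ u)) ⟩
    act (u ++ []) γ         ≡⟨ u≈pvq γ ⟩
    act (p ++ v ++ q) γ     ≡⟨ act-++ p (v ++ q) γ ⟩
    act p (act (v ++ q) γ)  ≡⟨ cong (act p) (act-++ v q γ) ⟩
    act p (act v (act q γ)) ∎
    where open ≡-Reasoning

theorem11p1 : (n : ℕ) (u v : Word n) → SameIdeal u v → u ≈S v
theorem11p1 n u v (u∈JvJ , v∈JuJ) γ = countUpTo-injective (act u γ) (act v γ) λ t →
  ≤-antisym (IdealSub⇒≽ v u v∈JuJ γ t) (IdealSub⇒≽ u v u∈JvJ γ t)
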